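{- Let $n\ge2$ and $\delta>0$, let $G$ be a bipartite graph on $2n$ vertices which is a $\delta$-expander, and let $M$ be a perfect matching of $G$. Then every edge of $G$ is contained in an alternating cycle (with respect to $M$) of length at most \[2+4\frac{\ln n}{\ln(1+\delta)}.\]
   Context: A bipartite graph $G=(U,V,E)$ is a $\delta$-expander if $|N(U')|\ge(1+\delta)|U'|$ for all $U'\subseteq U$ with $|U'|\le|U|/2$ and $|N(V')|\ge(1+\delta)|V'|$ for all $V'\subseteq V$ with $|V'|\le|V|/2$, where $N$ denotes the neighbourhood. Given a matching $M$, an even cycle is alternating if every other edge of the cycle belongs to $M$.
   Formalization: The expansion parameter δ ranges over the positive rationals. -}

module Defs where

open import Data.Nat as ℕ using (ℕ; zero; suc; NonZero)
open import Data.Nat.DivMod using (_mod_)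
open import Data.Integer using (+_)
open import Data.Rational as ℚ using (ℚ; 1ℚ)
open import Data.Bool using (Bool; true; false; _∨_; _∧_)
open import Data.Fin using (Fin; toℕ)
open import Data.Fin.Subset using (Subset; inside; outside; ∣_∣)
open import Data.Vec using (tabulate; lookup)
open import Data.List using (List; foldr)
open import Data.List using (allFin)
open import Data.Product using (Σ; _×_; ∃)
open import Data.Sum using (_⊎_)
open import Function.Definitions using (Injective)
open import Relation.Binary.PropositionalEquality using (_≡_)

-- A bipartite graph with sides U = Fin a and V = Fin b,
-- given by its (Boolean) biadjacency relation: E u v ≡ true iff uv is an edge.
BipGraph : ℕ → ℕ → Set
BipGraph a b = Fin a → Fin b → Bool

transpose : ∀ {a b} → BipGraph a b → BipGraph b a
transpose E v u = E u v

ℕ→ℚ : ℕ → ℚ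
ℕ→ℚ k = + k ℚ./ 1

_^ℚ_ : ℚ → ℕ → ℚ
q ^ℚ zero = 1ℚ
q ^ℚ suc k = q ℚ.* (q ^ℚ k)

anyFin : ∀ {a} → (Fin a → Bool) → Bool
anyFin {a} p = foldr (λ i r → p i ∨ r) false (allFin a)

member : ∀ {a} → Subset a → Fin a → Bool
member S u with lookup S u
... | inside = true
... | outside = false

N : ∀ {a b} → BipGraph a b → Subset a → Subset b
N E S = tabulate λ v → anyFin λ u → member S u ∧ E u v

ExpandsLeft : ∀ {a b} → ℚ → BipGraph a b → Set
ExpandsLeft {a} δ E = (S : Subset a) → 2 ℕ.* ∣ S ∣ ℕ.≤ a →
  (1ℚ ℚ.+ δ) ℚ.* ℕ→ℚ ∣ S ∣ ℚ.≤ ℕ→ℚ ∣ N E S ∣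

IsExpander : ∀ {a b} → ℚ → BipGraph a b → Set
IsExpander δ E = ExpandsLeft δ E × ExpandsLeft δ (transpose E)

-- A perfect matching of a bipartite graph with sides of size n:
-- every u ∈ U is matched to m u ∈ V (a G-edge), distinct u's to distinct v's
-- (hence m is a bijection, every vertex covered exactly once).
record PerfectMatching {n} (E : BipGraph n n) : Set where
  field
    m       : Fin n → Fin n
    m-inj   : Injective _≡_ _≡_ m
    m-edge  : ∀ u → E u (m u) ≡ true

next : ∀ {j} → Fin (suc j) → Fin (suc j)
next {j} i = suc (toℕ i) mod (suc j)

-- A cycle of length 2(j+1), j ≥ 1 (so length ≥ 4), in the bipartite graph:
--   us 0 – vs 0 – us 1 – vs 1 – … – us j – vs j – us 0
-- with pairwise distinct vertices.
record Cycle {n} (E : BipGraph n n) (j : ℕ) : Set where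
  field
    j≥1    : 1 ℕ.≤ j
    us     : Fin (suc j) → Fin n
    vs     : Fin (suc j) → Fin n
    us-inj : Injective _≡_ _≡_ us
    vs-inj : Injective _≡_ _≡_ vs
    edge₁  : ∀ i → E (us i) (vs i) ≡ true
    edge₂  : ∀ i → E (us (next i)) (vs i) ≡ true

cycleLength : ℕ → ℕ
cycleLength j = 2 ℕ.* suc j

Alternating : ∀ {n} {E : BipGraph n n} {j} → PerfectMatching E → Cycle E j → Set
Alternating M C =
  (∀ i → vs i ≡ m (us i)) ⊎ (∀ i → vs i ≡ m (us (next i)))
  where open PerfectMatching M; open Cycle C

ContainsEdge : ∀ {n} {E : BipGraph n n} {j} → Cycle E j → Fin n → Fin n → Set
ContainsEdge C u v =
  Σ _ λ i → (us i ≡ u × vs i ≡ v) ⊎ (us (next i) ≡ u × vs i ≡ v)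
  where open Cycle C

{-# OPTIONS --safe #-}
-- Relabel the V-side through the matching: in the digraph D on U with x → y iff x ∼ m(y), a directed
-- cycle x₀ → x₁ → ⋯ → x₀ is the alternating cycle x₀ m(x₁) x₁ m(x₂) ⋯ of G, and D is again a
-- δ-expander on both sides. Breadth-first layers out of w and into u grow by a factor 1+δ as long as
-- they have at most n/2 elements, so after a resp. b steps with (1+δ)^a, (1+δ)^b ≤ n both exceed n/2
-- and meet. Hence u is reachable from w in d ≤ a+b steps, and a shortest walk is a path. Closing it
-- with an arc u → w yields an alternating cycle of length 2(d+1) with (1+δ)^(2d) ≤ n⁴. A non-matching
-- edge uv is the arc u → m⁻¹(v); the matching edge u m(u) lies on the cycle through any arc u → w
-- with w ≠ u, which exists because |N(u)| ≥ 1+δ > 1.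

module Submission where

open import Defs
open import Data.Nat using (ℕ; _≤_; _∸_; _^_)
open import Data.Rational using (ℚ; 0ℚ; 1ℚ; _<_; _+_) renaming (_≤_ to _≤ℚ_)
open import Data.Fin using (Fin)
open import Data.Bool using (true)
open import Data.Product using (Σ; _×_)
open import Relation.Binary.PropositionalEquality using (_≡_)

open import Data.Nat as ℕ using (zero; suc; z≤n; s≤s)
import Data.Nat.Properties as ℕ
open import Data.Nat.DivMod using (_%_; m<n⇒m%n≡m; n%n≡0)
import Data.Nat.Coprimality as Coprime
open import Data.Integer as ℤ using (+_)
import Data.Integer.Properties as ℤ
open import Data.Rational as ℚ using (_*_; mkℚ; *≤*; *<*)
import Data.Rational.Properties as ℚ
open import Algebra.Properties.CommutativeMonoid.Sum ℕ.+-0-commutativeMonoid using (sum; sum-cong-≗; sum-permute)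
open import Data.Bool using (Bool; false; if_then_else_; _∧_; _∨_)
open import Data.Bool.ListAction using (any)
open import Data.Bool.Properties using (T-≡)
open import Data.Empty using (⊥-elim)
open import Data.Fin as Fin using (zero; suc; toℕ; fromℕ; inject₁; punchOut)
import Data.Fin.Properties as Fin
open import Data.Fin.Relation.Unary.Top using (view; ‵fromℕ; ‵inject₁)
open import Data.Fin.Permutation using (Permutation; permutation; flip; _⟨$⟩ʳ_; _⟨$⟩ˡ_; inverseʳ)
open import Data.Fin.Subset using (Subset; _∈_; _⊆_; ⁅_⁆; ∣_∣)
open import Data.Fin.Subset.Properties using (x∈⁅x⁆; x∈⁅y⁆⇒x≡y; ∣⁅x⁆∣≡1; ∣p∣≤n; p⊆q⇒∣p∣≤∣q∣; _∈?_)
open import Data.List using (allFin)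
import Data.List.Properties as List
open import Data.List.Membership.Propositional using (lose)
open import Data.List.Membership.Propositional.Properties using (∈-allFin)
open import Data.List.Relation.Unary.Any using (satisfied)
open import Data.List.Relation.Unary.Any.Properties using (any⁺; any⁻)
open import Data.Product as Product using (∃; ∃-syntax; _,_; proj₁; proj₂)
open import Data.Sum using (_⊎_; inj₁; inj₂)
open import Data.Vec using ([]; _∷_; lookup; tabulate; here; there)
open import Data.Vec.Functional using () renaming (_∷_ to _∷ᶠ_)
open import Data.Vec.Properties using ([]=⇒lookup; lookup⇒[]=; lookup∘tabulate; tabulate-cong)
open import Function using (_∘_; case_of_)
open import Function.Bundles using (Equivalence)
open import Function.Definitions using (Injective)
open import Relation.Binary.Definitions using (tri<; tri≈; tri>)
open import Relation.Binary.PropositionalEquality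
  using (_≢_; refl; sym; trans; cong; cong₂; subst; subst₂; module ≡-Reasoning)
open import Relation.Nullary using (¬_; ¬?; Dec; yes; no; _×-dec_)
open import Relation.Unary using (Decidable)

ℕ→ℚ≡mkℚ : ∀ k → ℕ→ℚ k ≡ mkℚ (+ k) 0 (Coprime.sym (Coprime.1-coprimeTo k))
ℕ→ℚ≡mkℚ k = ℚ.normalize-coprime (Coprime.sym (Coprime.1-coprimeTo k))

ℕ→ℚ-mono-≤ : ∀ {a b} → a ≤ b → ℕ→ℚ a ≤ℚ ℕ→ℚ b
ℕ→ℚ-mono-≤ {a} {b} a≤b rewrite ℕ→ℚ≡mkℚ a | ℕ→ℚ≡mkℚ b =
  *≤* (subst₂ ℤ._≤_ (sym (ℤ.*-identityʳ (+ a))) (sym (ℤ.*-identityʳ (+ b))) (ℤ.+≤+ a≤b))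

ℕ→ℚ-mono-< : ∀ {a b} → a ℕ.< b → ℕ→ℚ a < ℕ→ℚ b
ℕ→ℚ-mono-< {a} {b} a<b rewrite ℕ→ℚ≡mkℚ a | ℕ→ℚ≡mkℚ b =
  *<* (subst₂ ℤ._<_ (sym (ℤ.*-identityʳ (+ a))) (sym (ℤ.*-identityʳ (+ b))) (ℤ.+<+ a<b))

ℕ→ℚ-cancel-< : ∀ {a b} → ℕ→ℚ a < ℕ→ℚ b → a ℕ.< b
ℕ→ℚ-cancel-< {a} {b} a<b rewrite ℕ→ℚ≡mkℚ a | ℕ→ℚ≡mkℚ b with a<b
... | *<* p = ℤ.drop‿+<+ (subst₂ ℤ._<_ (ℤ.*-identityʳ (+ a)) (ℤ.*-identityʳ (+ b)) p)

ℕ→ℚ-homo-* : ∀ a b → ℕ→ℚ (a ℕ.* b) ≡ ℕ→ℚ a * ℕ→ℚ b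
ℕ→ℚ-homo-* a b rewrite ℕ→ℚ≡mkℚ a | ℕ→ℚ≡mkℚ b = cong (ℚ._/ 1) (ℤ.pos-* a b)

0≤ℕ→ℚ : ∀ k → 0ℚ ≤ℚ ℕ→ℚ k
0≤ℕ→ℚ k = ℕ→ℚ-mono-≤ {0} {k} z≤n

0≤1 : 0ℚ ≤ℚ 1ℚ
0≤1 = 0≤ℕ→ℚ 1

1<1+δ : ∀ {δ} → 0ℚ < δ → 1ℚ < 1ℚ + δ
1<1+δ {δ} 0<δ = subst (_< 1ℚ + δ) (ℚ.+-identityʳ 1ℚ) (ℚ.+-monoʳ-< 1ℚ 0<δ)

*-mono-≤-nonNeg : ∀ {p q r s} → 0ℚ ≤ℚ p → 0ℚ ≤ℚ s → p ≤ℚ q → r ≤ℚ s → p * r ≤ℚ q * s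
*-mono-≤-nonNeg {p} {q} {r} {s} 0≤p 0≤s p≤q r≤s = ℚ.≤-trans
  (ℚ.*-monoˡ-≤-nonNeg p {{ℚ.nonNegative 0≤p}} r≤s)
  (ℚ.*-monoʳ-≤-nonNeg s {{ℚ.nonNegative 0≤s}} p≤q)

c*s≤t⇒s<t : ∀ {c s t} → 1ℚ < c → 0 ℕ.< s → c * ℕ→ℚ s ≤ℚ ℕ→ℚ t → s ℕ.< t
c*s≤t⇒s<t {c} {s} {t} 1<c 0<s cs≤t = ℕ→ℚ-cancel-< (begin-strict
  ℕ→ℚ s        ≡⟨ sym (ℚ.*-identityˡ (ℕ→ℚ s)) ⟩
  1ℚ * ℕ→ℚ s   <⟨ ℚ.*-monoˡ-<-pos (ℕ→ℚ s) {{ℚ.positive (ℕ→ℚ-mono-< 0<s)}} 1<c ⟩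
  c * ℕ→ℚ s    ≤⟨ cs≤t ⟩
  ℕ→ℚ t        ∎)
  where open ℚ.≤-Reasoning

^ℚ-homo-+ : ∀ c a b → c ^ℚ (a ℕ.+ b) ≡ c ^ℚ a * c ^ℚ b
^ℚ-homo-+ c zero    b = sym (ℚ.*-identityˡ (c ^ℚ b))
^ℚ-homo-+ c (suc a) b = trans (cong (c *_) (^ℚ-homo-+ c a b)) (sym (ℚ.*-assoc c (c ^ℚ a) (c ^ℚ b)))

module _ {c : ℚ} (1≤c : 1ℚ ≤ℚ c) where

  1≤^ℚ : ∀ k → 1ℚ ≤ℚ c ^ℚ k
  1≤^ℚ zero    = ℚ.≤-refl
  1≤^ℚ (suc k) = *-mono-≤-nonNeg 0≤1 (ℚ.≤-trans 0≤1 (1≤^ℚ k)) 1≤c (1≤^ℚ k)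

  0≤^ℚ : ∀ k → 0ℚ ≤ℚ c ^ℚ k
  0≤^ℚ k = ℚ.≤-trans 0≤1 (1≤^ℚ k)

  ^ℚ-monoʳ-≤ : ∀ {a b} → a ≤ b → c ^ℚ a ≤ℚ c ^ℚ b
  ^ℚ-monoʳ-≤ {a} a≤b with ℕ.m≤n⇒∃[o]m+o≡n a≤b
  ... | o , refl = begin
    c ^ℚ a               ≡⟨ sym (ℚ.*-identityʳ (c ^ℚ a)) ⟩
    c ^ℚ a * 1ℚ          ≤⟨ ℚ.*-monoˡ-≤-nonNeg (c ^ℚ a) {{ℚ.nonNegative (0≤^ℚ a)}} (1≤^ℚ o) ⟩
    c ^ℚ a * c ^ℚ o      ≡⟨ sym (^ℚ-homo-+ c a o) ⟩
    c ^ℚ (a ℕ.+ o)       ∎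
    where open ℚ.≤-Reasoning

  ^ℚ-+-≤-* : ∀ {a b x y} → c ^ℚ a ≤ℚ ℕ→ℚ x → c ^ℚ b ≤ℚ ℕ→ℚ y → c ^ℚ (a ℕ.+ b) ≤ℚ ℕ→ℚ (x ℕ.* y)
  ^ℚ-+-≤-* {a} {b} {x} {y} ca≤x cb≤y = begin
    c ^ℚ (a ℕ.+ b)       ≡⟨ ^ℚ-homo-+ c a b ⟩
    c ^ℚ a * c ^ℚ b      ≤⟨ *-mono-≤-nonNeg (0≤^ℚ a) (0≤ℕ→ℚ y) ca≤x cb≤y ⟩
    ℕ→ℚ x * ℕ→ℚ y        ≡⟨ sym (ℕ→ℚ-homo-* x y) ⟩
    ℕ→ℚ (x ℕ.* y)        ∎
    where open ℚ.≤-Reasoning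

-- Least solutions and expanding sequences

Least : (ℕ → Set) → ℕ → Set
Least P k = P k × (∀ {j} → j ℕ.< k → ¬ P j)

Least-unique : ∀ {P a b} → Least P a → Least P b → a ≡ b
Least-unique {a = a} {b} (Pa , below-a) (Pb , below-b) with ℕ.<-cmp a b
... | tri< a<b _ _ = ⊥-elim (below-b a<b Pa)
... | tri≈ _ a≡b _ = a≡b
... | tri> _ _ b<a = ⊥-elim (below-a b<a Pb)

least-below : ∀ {P} → Decidable P → ∀ k → (∃[ j ] j ℕ.< k × Least P j) ⊎ (∀ {j} → j ℕ.< k → ¬ P j)
least-below P? zero = inj₂ λ ()
least-below P? (suc k) with least-below P? k
... | inj₁ (j , j<k , least) = inj₁ (j , ℕ.m<n⇒m<1+n j<k , least)
... | inj₂ none with P? k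
...   | yes Pk = inj₁ (k , ℕ.n<1+n k , Pk , none)
...   | no ¬Pk = inj₂ λ j<1+k → case ℕ.m≤n⇒m<n∨m≡n (ℕ.≤-pred j<1+k) of λ
        { (inj₁ j<k) → none j<k
        ; (inj₂ refl) → ¬Pk }

n<2a⇒n<2b⇒n<a+b : ∀ {n a b} → n ℕ.< 2 ℕ.* a → n ℕ.< 2 ℕ.* b → n ℕ.< a ℕ.+ b
n<2a⇒n<2b⇒n<a+b {n} {a} {b} n<2a n<2b = ℕ.*-cancelˡ-< 2 n (a ℕ.+ b)
  (subst₂ ℕ._<_ (cong (n ℕ.+_) (sym (ℕ.+-identityʳ n))) (sym (ℕ.*-distribˡ-+ 2 a b)) (ℕ.+-mono-< n<2a n<2b))

module _ {c : ℚ} (1<c : 1ℚ < c) {n : ℕ} {s : ℕ → ℕ} (s0≡1 : s 0 ≡ 1)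
         (expands : ∀ k → 2 ℕ.* s k ≤ n → c * ℕ→ℚ (s k) ≤ℚ ℕ→ℚ (s (suc k))) where

  geometric-growth : ∀ k → (∀ {j} → j ℕ.< k → 2 ℕ.* s j ≤ n) → c ^ℚ k ≤ℚ ℕ→ℚ (s k) × k ℕ.< s k
  geometric-growth zero    _     rewrite s0≡1 = ℚ.≤-refl , ℕ.n<1+n 0
  geometric-growth (suc k) small =
    let c^k≤sk , k<sk = geometric-growth k (small ∘ ℕ.m<n⇒m<1+n)
        step         = expands k (small (ℕ.n<1+n k))
    in ℚ.≤-trans (ℚ.*-monoˡ-≤-nonNeg c {{c≥0}} c^k≤sk) step ,
       ℕ.≤-trans (s≤s k<sk) (c*s≤t⇒s<t 1<c (ℕ.<-≤-trans (s≤s z≤n) k<sk) step)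
    where c≥0 = ℚ.nonNegative (ℚ.≤-trans 0≤1 (ℚ.<⇒≤ 1<c))

  -- While below n/2 the sequence increases strictly, so it passes n/2 within n + 1 steps.
  exceeds-half : (∀ k → s k ≤ n) → ∃[ a ] c ^ℚ a ≤ℚ ℕ→ℚ n × n ℕ.< 2 ℕ.* s a
  exceeds-half bounded with least-below (λ k → n ℕ.<? 2 ℕ.* s k) (suc n)
  ... | inj₁ (a , _ , big , below) =
    a , ℚ.≤-trans (proj₁ (geometric-growth a (ℕ.≮⇒≥ ∘ below))) (ℕ→ℚ-mono-≤ (bounded a)) , big
  ... | inj₂ none = ⊥-elim (ℕ.<⇒≱ (proj₂ (geometric-growth (suc n) (ℕ.≮⇒≥ ∘ none))) (ℕ.m≤n⇒m≤1+n (bounded (suc n))))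

anyFin≡any : ∀ {a} (p : Fin a → Bool) → anyFin p ≡ any p (allFin a)
anyFin≡any p = sym (List.foldr-map _∨_ p false (allFin _))

anyFin⁺ : ∀ {a} (p : Fin a → Bool) {i} → p i ≡ true → anyFin p ≡ true
anyFin⁺ p {i} pi = trans (anyFin≡any p)
  (Equivalence.to T-≡ (any⁺ p (lose (∈-allFin i) (Equivalence.from T-≡ pi))))

anyFin⁻ : ∀ {a} (p : Fin a → Bool) → anyFin p ≡ true → ∃ λ i → p i ≡ true
anyFin⁻ p some = Product.map₂ (Equivalence.to T-≡)
  (satisfied (any⁻ p (allFin _) (Equivalence.from T-≡ (trans (sym (anyFin≡any p)) some))))

member≡lookup : ∀ {a} (S : Subset a) u → member S u ≡ lookup S u
member≡lookup S u with lookup S u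
... | true  = refl
... | false = refl

∧≡true⁻ : ∀ {x y} → x ∧ y ≡ true → x ≡ true × y ≡ true
∧≡true⁻ {true} {true} _ = refl , refl

module _ {a b} (E : BipGraph a b) (S : Subset a) where

  ∈N⁺ : ∀ {u v} → u ∈ S → E u v ≡ true → v ∈ N E S
  ∈N⁺ {u} {v} u∈S uv = lookup⇒[]= v (N E S) (trans (lookup∘tabulate _ v)
    (anyFin⁺ (λ x → member S x ∧ E x v) (cong₂ _∧_ (trans (member≡lookup S u) ([]=⇒lookup u∈S)) uv)))

  ∈N⁻ : ∀ {v} → v ∈ N E S → ∃ λ u → u ∈ S × E u v ≡ true
  ∈N⁻ {v} v∈N =
    let u , Su∧uv = anyFin⁻ (λ x → member S x ∧ E x v) (trans (sym (lookup∘tabulate _ v)) ([]=⇒lookup v∈N))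
        Su , uv   = ∧≡true⁻ Su∧uv
    in u , lookup⇒[]= u S (trans (sym (member≡lookup S u)) Su) , uv

preimage : ∀ {a b} → (Fin a → Fin b) → Subset b → Subset a
preimage f S = tabulate (lookup S ∘ f)

∈-preimage⁻ : ∀ {a b} (f : Fin a → Fin b) S {x} → x ∈ preimage f S → f x ∈ S
∈-preimage⁻ f S {x} x∈ = lookup⇒[]= (f x) S (trans (sym (lookup∘tabulate _ x)) ([]=⇒lookup x∈))

N-precomposeʳ : ∀ {a b c} (E : BipGraph a b) (f : Fin c → Fin b) S →
  N (λ u v → E u (f v)) S ≡ preimage f (N E S)
N-precomposeʳ E f S = tabulate-cong λ v → sym (lookup∘tabulate _ (f v))

indicator : Bool → ℕ
indicator b = if b then 1 else 0

∣p∣≡sum : ∀ {k} (S : Subset k) → ∣ S ∣ ≡ sum (indicator ∘ lookup S)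
∣p∣≡sum []          = refl
∣p∣≡sum (true ∷ S)  = cong suc (∣p∣≡sum S)
∣p∣≡sum (false ∷ S) = ∣p∣≡sum S

∣preimage∣≡∣p∣ : ∀ {k} (π : Permutation k k) S → ∣ preimage (π ⟨$⟩ʳ_) S ∣ ≡ ∣ S ∣
∣preimage∣≡∣p∣ π S = begin
  ∣ preimage (π ⟨$⟩ʳ_) S ∣                            ≡⟨ ∣p∣≡sum (preimage (π ⟨$⟩ʳ_) S) ⟩
  sum (indicator ∘ lookup (preimage (π ⟨$⟩ʳ_) S))     ≡⟨ sum-cong-≗ (cong indicator ∘ lookup∘tabulate (lookup S ∘ (π ⟨$⟩ʳ_))) ⟩
  sum (indicator ∘ lookup S ∘ (π ⟨$⟩ʳ_))              ≡⟨ sym (sum-permute (indicator ∘ lookup S) π) ⟩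
  sum (indicator ∘ lookup S)                           ≡⟨ sym (∣p∣≡sum S) ⟩
  ∣ S ∣                                                ∎
  where open ≡-Reasoning

large-subsets-meet : ∀ {k} (p q : Subset k) → k ℕ.< ∣ p ∣ ℕ.+ ∣ q ∣ → ∃ λ x → x ∈ p × x ∈ q
large-subsets-meet []          []          ()
large-subsets-meet (true  ∷ p) (true  ∷ q) _ = zero , here , here
large-subsets-meet (true  ∷ p) (false ∷ q) big =
  Product.map suc (Product.map there there) (large-subsets-meet p q (ℕ.≤-pred big))
large-subsets-meet (false ∷ p) (true  ∷ q) big rewrite ℕ.+-suc ∣ p ∣ ∣ q ∣ =
  Product.map suc (Product.map there there) (large-subsets-meet p q (ℕ.≤-pred big))
large-subsets-meet {suc k} (false ∷ p) (false ∷ q) big =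
  Product.map suc (Product.map there there) (large-subsets-meet p q (ℕ.<-trans (ℕ.n<1+n k) big))

other-element : ∀ {k} (p : Subset k) z → 1 ℕ.< ∣ p ∣ → ∃ λ x → x ∈ p × x ≢ z
other-element p z big with Fin.any? (λ x → x ∈? p ×-dec ¬? (x Fin.≟ z))
... | yes found = found
... | no none = ⊥-elim (ℕ.<⇒≱ big (subst (∣ p ∣ ≤_) (∣⁅x⁆∣≡1 z) (p⊆q⇒∣p∣≤∣q∣ p⊆⁅z⁆)))
  where
  p⊆⁅z⁆ : p ⊆ ⁅ z ⁆
  p⊆⁅z⁆ {x} x∈p with x Fin.≟ z
  ... | yes refl = x∈⁅x⁆ z
  ... | no x≢z  = ⊥-elim (none (x , x∈p , x≢z))

-- Relabelling by a permutation preserves expansion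

injective⇒surjective : ∀ {k} {f : Fin k → Fin k} → Injective _≡_ _≡_ f → ∀ y → ∃ λ x → f x ≡ y
injective⇒surjective {suc k} {f} f-injective y with Fin.any? (λ x → f x Fin.≟ y)
... | yes hit = hit
... | no miss = ⊥-elim (ℕ.1+n≰n (Fin.injective⇒≤ punchOut-y∘f-injective))
  where
  y≢f : ∀ x → y ≢ f x
  y≢f x eq = miss (x , sym eq)
  punchOut-y∘f-injective : Injective _≡_ _≡_ (λ x → punchOut (y≢f x))
  punchOut-y∘f-injective eq = f-injective (Fin.punchOut-injective (y≢f _) (y≢f _) eq)

injective⇒permutation : ∀ {k} (f : Fin k → Fin k) → Injective _≡_ _≡_ f → Permutation k k
injective⇒permutation f f-injective =
  permutation f (proj₁ ∘ surjective) (proj₂ ∘ surjective) (λ x → f-injective (proj₂ (surjective (f x))))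
  where surjective = injective⇒surjective f-injective

module _ {δ : ℚ} where

  ExpandsLeft-permuteʳ : ∀ {a b} {E : BipGraph a b} (π : Permutation b b) →
    ExpandsLeft δ E → ExpandsLeft δ (λ u v → E u (π ⟨$⟩ʳ v))
  ExpandsLeft-permuteʳ {E = E} π expands S small = begin
    (1ℚ + δ) * ℕ→ℚ ∣ S ∣                      ≤⟨ expands S small ⟩
    ℕ→ℚ ∣ N E S ∣                             ≡⟨ cong ℕ→ℚ (sym (∣preimage∣≡∣p∣ π (N E S))) ⟩
    ℕ→ℚ ∣ preimage (π ⟨$⟩ʳ_) (N E S) ∣        ≡⟨ cong (ℕ→ℚ ∘ ∣_∣) (sym (N-precomposeʳ E (π ⟨$⟩ʳ_) S)) ⟩
    ℕ→ℚ ∣ N (λ u v → E u (π ⟨$⟩ʳ v)) S ∣      ∎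
    where open ℚ.≤-Reasoning

  ExpandsLeft-permuteˡ : ∀ {a b} {E : BipGraph a b} (π : Permutation a a) →
    ExpandsLeft δ E → ExpandsLeft δ (λ u v → E (π ⟨$⟩ʳ u) v)
  ExpandsLeft-permuteˡ {a} {E = E} π expands S small = begin
    (1ℚ + δ) * ℕ→ℚ ∣ S ∣                      ≡⟨ cong (λ s → (1ℚ + δ) * ℕ→ℚ s) (sym ∣T∣≡∣S∣) ⟩
    (1ℚ + δ) * ℕ→ℚ ∣ T ∣                      ≤⟨ expands T (subst (λ s → 2 ℕ.* s ≤ a) (sym ∣T∣≡∣S∣) small) ⟩
    ℕ→ℚ ∣ N E T ∣                             ≤⟨ ℕ→ℚ-mono-≤ (p⊆q⇒∣p∣≤∣q∣ N[T]⊆) ⟩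
    ℕ→ℚ ∣ N (λ u v → E (π ⟨$⟩ʳ u) v) S ∣      ∎
    where
    open ℚ.≤-Reasoning
    T = preimage (π ⟨$⟩ˡ_) S
    ∣T∣≡∣S∣ : ∣ T ∣ ≡ ∣ S ∣
    ∣T∣≡∣S∣ = ∣preimage∣≡∣p∣ (flip π) S
    N[T]⊆ : N E T ⊆ N (λ u v → E (π ⟨$⟩ʳ u) v) S
    N[T]⊆ v∈ =
      let u , u∈T , uv = ∈N⁻ E T v∈
      in ∈N⁺ (λ u v → E (π ⟨$⟩ʳ u) v) S (∈-preimage⁻ (π ⟨$⟩ˡ_) S u∈T)
           (subst (λ w → E w _ ≡ true) (sym (inverseʳ π)) uv)

  IsExpander-permuteʳ : ∀ {a b} {E : BipGraph a b} (π : Permutation b b) →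
    IsExpander δ E → IsExpander δ (λ u v → E u (π ⟨$⟩ʳ v))
  IsExpander-permuteʳ {E = E} π (left , right) =
    ExpandsLeft-permuteʳ π left , ExpandsLeft-permuteˡ {E = transpose E} π right

other-neighbour : ∀ {a b δ} {D : BipGraph a b} → 0ℚ < δ → ExpandsLeft δ D → 2 ≤ a →
  ∀ u z → ∃ λ w → D u w ≡ true × w ≢ z
other-neighbour {δ = δ} {D} 0<δ expands 2≤a u z =
  let w , w∈N , w≢z    = other-element (N D ⁅ u ⁆) z two-neighbours
      u′ , u′∈⁅u⁆ , u′w = ∈N⁻ D ⁅ u ⁆ w∈N
  in w , subst (λ x → D x w ≡ true) (x∈⁅y⁆⇒x≡y u u′∈⁅u⁆) u′w , w≢z
  where
  two-neighbours : 1 ℕ.< ∣ N D ⁅ u ⁆ ∣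
  two-neighbours = c*s≤t⇒s<t (1<1+δ 0<δ) (s≤s z≤n)
    (subst (λ s → (1ℚ + δ) * ℕ→ℚ s ≤ℚ ℕ→ℚ ∣ N D ⁅ u ⁆ ∣) (∣⁅x⁆∣≡1 u)
      (expands ⁅ u ⁆ (subst (λ s → 2 ℕ.* s ≤ _) (sym (∣⁅x⁆∣≡1 u)) 2≤a)))

toℕ-next : ∀ {k} (i : Fin (suc k)) → toℕ (next i) ≡ suc (toℕ i) % suc k
toℕ-next i = Fin.toℕ-fromℕ< _

next-inject₁ : ∀ {k} (i : Fin k) → next (inject₁ i) ≡ suc i
next-inject₁ {k} i = Fin.toℕ-injective (begin
  toℕ (next (inject₁ i))          ≡⟨ toℕ-next (inject₁ i) ⟩
  suc (toℕ (inject₁ i)) % suc k   ≡⟨ cong (λ t → suc t % suc k) (Fin.toℕ-inject₁ i) ⟩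
  suc (toℕ i) % suc k             ≡⟨ m<n⇒m%n≡m (s≤s (Fin.toℕ<n i)) ⟩
  suc (toℕ i)                     ∎)
  where open ≡-Reasoning

next-fromℕ : ∀ k → next (fromℕ k) ≡ zero
next-fromℕ k = Fin.toℕ-injective (begin
  toℕ (next (fromℕ k))            ≡⟨ toℕ-next (fromℕ k) ⟩
  suc (toℕ (fromℕ k)) % suc k     ≡⟨ cong (λ t → suc t % suc k) (Fin.toℕ-fromℕ k) ⟩
  suc k % suc k                   ≡⟨ n%n≡0 (suc k) ⟩
  0                               ∎)
  where open ≡-Reasoning

next-injective : ∀ {k} → Injective _≡_ _≡_ (next {k})
next-injective {k} {i} {j} eq with view i | view j
... | ‵fromℕ      | ‵fromℕ      = refl
... | ‵fromℕ      | ‵inject₁ j′ = ⊥-elim (Fin.0≢1+n (trans (sym (next-fromℕ k)) (trans eq (next-inject₁ j′))))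
... | ‵inject₁ i′ | ‵fromℕ      = ⊥-elim (Fin.0≢1+n (trans (sym (next-fromℕ k)) (trans (sym eq) (next-inject₁ i′))))
... | ‵inject₁ i′ | ‵inject₁ j′ =
  cong inject₁ (Fin.suc-injective (trans (sym (next-inject₁ i′)) (trans eq (next-inject₁ j′))))

-- Layers, geodesics and directed cycles

layer : ∀ {n} → BipGraph n n → Fin n → ℕ → Subset n
layer D s zero    = ⁅ s ⁆
layer D s (suc k) = N D (layer D s k)

layer-join : ∀ {n} (D : BipGraph n n) {w u x} a {b} →
  x ∈ layer D w a → x ∈ layer (transpose D) u b → w ∈ layer (transpose D) u (a ℕ.+ b)
layer-join D zero x∈ x∈′ rewrite x∈⁅y⁆⇒x≡y _ x∈ = x∈′
layer-join D {w} {u} (suc a) {b} x∈ x∈′ with ∈N⁻ D (layer D w a) x∈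
... | y , y∈ , yx = subst (λ k → w ∈ layer (transpose D) u k) (ℕ.+-suc a b)
  (layer-join D a y∈ (∈N⁺ (transpose D) (layer (transpose D) u b) x∈′ yx))

module _ {n} (D : BipGraph n n) (y : Fin n) where

  -- layer (transpose D) y k holds the vertices with a walk of length k to y.
  Distance : Fin n → ℕ → Set
  Distance x = Least (λ k → x ∈ layer (transpose D) y k)

  record Geodesic (k : ℕ) (x : Fin n) : Set where
    field
      vertex      : Fin (suc k) → Fin n
      vertex-zero : vertex zero ≡ x
      vertex-last : vertex (fromℕ k) ≡ y
      arc         : ∀ i → D (vertex (inject₁ i)) (vertex (suc i)) ≡ true
      distance    : ∀ i → Distance (vertex i) (k ∸ toℕ i)

    -- A repeated vertex would have two different distances to y.
    vertex-injective : Injective _≡_ _≡_ vertex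
    vertex-injective {i} {j} eq = Fin.toℕ-injective (ℕ.∸-cancelˡ-≡ (Fin.toℕ≤pred[n] i) (Fin.toℕ≤pred[n] j)
      (Least-unique (distance i) (subst (λ v → Distance v (k ∸ toℕ j)) (sym eq) (distance j))))

  geodesic : ∀ {k x} → Distance x k → Geodesic k x
  geodesic {zero} (x∈⁅y⁆ , _) = record
    { vertex      = λ _ → y
    ; vertex-zero = sym (x∈⁅y⁆⇒x≡y y x∈⁅y⁆)
    ; vertex-last = refl
    ; arc         = λ ()
    ; distance    = λ { zero → x∈⁅x⁆ y , λ () }
    }
  geodesic {suc k} {x} (x∈ , closer) with ∈N⁻ (transpose D) (layer (transpose D) y k) x∈
  ... | z , z∈ , xz = record
    { vertex      = x ∷ᶠ G.vertex
    ; vertex-zero = refl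
    ; vertex-last = G.vertex-last
    ; arc         = λ { zero → subst (λ v → D x v ≡ true) (sym G.vertex-zero) xz ; (suc i) → G.arc i }
    ; distance    = λ { zero → x∈ , closer ; (suc i) → G.distance i }
    }
    where
    z-distance : Distance z k
    z-distance = z∈ , λ {j} j<k z∈j → closer (s≤s j<k) (∈N⁺ (transpose D) (layer (transpose D) y j) z∈j xz)
    module G = Geodesic (geodesic z-distance)

record DiCycle {n} (D : BipGraph n n) (k : ℕ) : Set where
  field
    vertex           : Fin (suc k) → Fin n
    vertex-injective : Injective _≡_ _≡_ vertex
    arc              : ∀ i → D (vertex i) (vertex (next i)) ≡ true

closeGeodesic : ∀ {n} {D : BipGraph n n} {u w k} → Geodesic D u k w → D u w ≡ true → DiCycle D k
closeGeodesic {D = D} {u} {w} {k} g uw = record { vertex = vertex ; vertex-injective = vertex-injective ; arc = arc′ }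
  where
  open Geodesic g
  arc′ : ∀ i → D (vertex i) (vertex (next i)) ≡ true
  arc′ i with view i
  ... | ‵fromℕ     = subst₂ (λ a b → D a b ≡ true) (sym vertex-last)
                       (trans (sym vertex-zero) (cong vertex (sym (next-fromℕ k)))) uw
  ... | ‵inject₁ j = subst (λ b → D (vertex (inject₁ j)) b ≡ true) (cong vertex (sym (next-inject₁ j))) (arc j)

layer-exceeds-half : ∀ {n δ} {A : BipGraph n n} → 0ℚ < δ → ExpandsLeft δ A → ∀ s →
  ∃[ a ] (1ℚ + δ) ^ℚ a ≤ℚ ℕ→ℚ n × n ℕ.< 2 ℕ.* ∣ layer A s a ∣
layer-exceeds-half {A = A} 0<δ expands s =
  exceeds-half (1<1+δ 0<δ) (∣⁅x⁆∣≡1 s) (λ k → expands (layer A s k)) (λ k → ∣p∣≤n (layer A s k))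

short-geodesic : ∀ {n δ} {D : BipGraph n n} → 0ℚ < δ → IsExpander δ D →
  ∀ w u → ∃[ d ] Geodesic D u d w × (1ℚ + δ) ^ℚ d ≤ℚ ℕ→ℚ (n ℕ.* n)
short-geodesic {n} {δ} {D} 0<δ expander w u =
  let a , ca≤n , big-out = layer-exceeds-half 0<δ (proj₁ expander) w
      b , cb≤n , big-in  = layer-exceeds-half 0<δ (proj₂ expander) u
      x , x∈out , x∈in   = large-subsets-meet (layer D w a) (layer (transpose D) u b)
                             (n<2a⇒n<2b⇒n<a+b {n} {∣ layer D w a ∣} {∣ layer (transpose D) u b ∣} big-out big-in)
      1≤c = ℚ.<⇒≤ (1<1+δ 0<δ)
  in case least-below (λ k → w ∈? layer (transpose D) u k) (suc (a ℕ.+ b)) of λ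
    { (inj₁ (d , d<1+a+b , w-distance)) → d , geodesic D u w-distance ,
        ℚ.≤-trans (^ℚ-monoʳ-≤ 1≤c (ℕ.≤-pred d<1+a+b)) (^ℚ-+-≤-* 1≤c {a} {b} {n} {n} ca≤n cb≤n)
    ; (inj₂ none) → ⊥-elim (none (ℕ.n<1+n (a ℕ.+ b)) (layer-join D a x∈out x∈in))
    }

-- Alternating cycles

cycleLength∸2 : ∀ d → cycleLength d ∸ 2 ≡ d ℕ.+ d
cycleLength∸2 d rewrite ℕ.+-identityʳ d | ℕ.+-suc d d = refl

n^4≡n²*n² : ∀ n → n ^ 4 ≡ (n ℕ.* n) ℕ.* (n ℕ.* n)
n^4≡n²*n² n rewrite ℕ.*-identityʳ n = sym (ℕ.*-assoc n n (n ℕ.* n))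

module _ {n} {E : BipGraph n n} (M : PerfectMatching E) where
  open PerfectMatching M

  matching : Permutation n n
  matching = injective⇒permutation m m-inj

  matchingDigraph : BipGraph n n
  matchingDigraph x y = E x (matching ⟨$⟩ʳ y)

  alternatingCycle : ∀ {k} → 1 ≤ k → DiCycle matchingDigraph k → Cycle E k
  alternatingCycle 1≤k Z = record
    { j≥1    = 1≤k
    ; us     = vertex
    ; vs     = m ∘ vertex ∘ next
    ; us-inj = vertex-injective
    ; vs-inj = next-injective ∘ vertex-injective ∘ m-inj
    ; edge₁  = arc
    ; edge₂  = m-edge ∘ vertex ∘ next
    }
    where open DiCycle Z

  module _ {δ} (0<δ : 0ℚ < δ) (expander : IsExpander δ E) where

    ShortAlternatingCycle : Fin n → Fin n → Set
    ShortAlternatingCycle u v = Σ ℕ λ j → Σ (Cycle E j) λ C → Alternating M C × ContainsEdge C u v ×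
      ((1ℚ + δ) ^ℚ (cycleLength j ∸ 2) ≤ℚ ℕ→ℚ (n ^ 4))

    cycles-around-geodesic : ∀ {u w d} → w ≢ u → matchingDigraph u w ≡ true →
      Geodesic matchingDigraph u d w → (1ℚ + δ) ^ℚ d ≤ℚ ℕ→ℚ (n ℕ.* n) →
      ShortAlternatingCycle u (m w) × ShortAlternatingCycle u (m u)
    cycles-around-geodesic {d = zero} w≢u _ g _ = ⊥-elim (w≢u (trans (sym vertex-zero) vertex-last))
      where open Geodesic g
    cycles-around-geodesic {u} {w} {suc d} _ uw g c^d≤n² =
      (suc d , C , alternating , (fromℕ (suc d) , inj₁ (vertex-last , cong m w-after-u)) , bound) ,
      (suc d , C , alternating , (inject₁ (fromℕ d) , inj₂ (u-after-penultimate , cong m u-after-penultimate)) , bound)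
      where
      open Geodesic g
      C = alternatingCycle (s≤s z≤n) (closeGeodesic g uw)
      alternating : Alternating M C
      alternating = inj₂ λ _ → refl
      w-after-u : vertex (next (fromℕ (suc d))) ≡ w
      w-after-u = trans (cong vertex (next-fromℕ (suc d))) vertex-zero
      u-after-penultimate : vertex (next (inject₁ (fromℕ d))) ≡ u
      u-after-penultimate = trans (cong vertex (next-inject₁ (fromℕ d))) vertex-last
      bound : (1ℚ + δ) ^ℚ (cycleLength (suc d) ∸ 2) ≤ℚ ℕ→ℚ (n ^ 4)
      bound = subst₂ (λ e k → (1ℚ + δ) ^ℚ e ≤ℚ ℕ→ℚ k) (sym (cycleLength∸2 (suc d))) (sym (n^4≡n²*n² n))
        (^ℚ-+-≤-* (ℚ.<⇒≤ (1<1+δ 0<δ)) {suc d} {suc d} {n ℕ.* n} {n ℕ.* n} c^d≤n² c^d≤n²)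

    arc-on-short-alternating-cycle : ∀ {u w} → w ≢ u → matchingDigraph u w ≡ true →
      ShortAlternatingCycle u (m w) × ShortAlternatingCycle u (m u)
    arc-on-short-alternating-cycle {u} {w} w≢u uw =
      let _ , g , c^d≤n² = short-geodesic 0<δ (IsExpander-permuteʳ {δ} matching expander) w u
      in cycles-around-geodesic w≢u uw g c^d≤n²

lemma6p3 : (n : ℕ) → 2 ≤ n → (δ : ℚ) → 0ℚ < δ →
    (E : BipGraph n n) → IsExpander δ E → (M : PerfectMatching E) →
    (u v : Fin n) → E u v ≡ true →
    Σ ℕ λ j → Σ (Cycle E j) λ C → Alternating M C × ContainsEdge C u v ×
    ((1ℚ + δ) ^ℚ (cycleLength j ∸ 2) ≤ℚ ℕ→ℚ (n ^ 4))
lemma6p3 n 2≤n δ 0<δ E expander M u v uv = by-cases (v Fin.≟ m u)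
  where
  open PerfectMatching M
  π = matching M
  Goal = ShortAlternatingCycle M 0<δ expander u
  -- A matching edge is closed into a cycle through another neighbour of u.
  by-cases : Dec (v ≡ m u) → Goal v
  by-cases (yes v≡mu) =
    let w , uw , w≢u = other-neighbour 0<δ (proj₁ (IsExpander-permuteʳ {δ} π expander)) 2≤n u u
    in subst Goal (sym v≡mu) (proj₂ (arc-on-short-alternating-cycle M 0<δ expander w≢u uw))
  by-cases (no v≢mu) = subst Goal (inverseʳ π) (proj₁ (arc-on-short-alternating-cycle M 0<δ expander w≢u uw))
    where
    w = π ⟨$⟩ˡ v
    uw : matchingDigraph M u w ≡ true
    uw = subst (λ x → E u x ≡ true) (sym (inverseʳ π)) uv
    w≢u : w ≢ u
    w≢u w≡u = v≢mu (trans (sym (inverseʳ π)) (cong m w≡u))
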